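{- Let $N\ge1$, $f:\mathbb{N}^N\to\mathbb{N}$, $p$ a prime and $\boldsymbol{\ell}\in\mathbb{N}^N$. Then $\binom{p}{\boldsymbol{\ell}}_f\equiv f(\mathbf{m})\pmod p$ if $\boldsymbol{\ell}=p\mathbf{m}$ for some $\mathbf{m}\in\mathbb{N}^N$, and $\binom{p}{\boldsymbol{\ell}}_f\equiv0\pmod p$ otherwise.
   Context: $\mathbb{N}=\{0,1,2,\dots\}$. For $k\ge0$ and $\boldsymbol{\ell}\in\mathbb{N}^N$, $\binom{k}{\boldsymbol{\ell}}_f=\sum f(\mathbf{m}_1)\cdots f(\mathbf{m}_k)$ over all ordered $k$-tuples of vectors $\mathbf{m}_j\in\mathbb{N}^N$ with $\mathbf{m}_1+\cdots+\mathbf{m}_k=\boldsymbol{\ell}$ (number of $f$-weighted vector compositions of $\boldsymbol{\ell}$ with $k$ parts). -}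

module Defs where

open import Data.Nat using (ℕ; zero; suc; _+_; _*_)
open import Data.Nat.Properties using (_≟_)
open import Data.List using (List; []; _∷_; map; concatMap; upTo; filter)
open import Data.Nat.ListAction using (sum; product)
open import Data.Vec using (Vec; []; _∷_; replicate; zipWith; toList; map)
open import Data.Vec.Properties using ()
open import Data.Vec.Relation.Binary.Equality.DecPropositional _≟_ using (_≡?_)

_⊕_ : ∀ {N} → Vec ℕ N → Vec ℕ N → Vec ℕ N
_⊕_ = zipWith _+_

_·_ : ∀ {N} → ℕ → Vec ℕ N → Vec ℕ N
c · m = Data.Vec.map (c *_) m

box : ∀ {N} → Vec ℕ N → List (Vec ℕ N)
box [] = [] ∷ []
box (l ∷ ls) = concatMap (λ a → Data.List.map (a ∷_) (box ls)) (upTo (suc l))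

tuples : ∀ {N} (k : ℕ) → Vec ℕ N → List (Vec (Vec ℕ N) k)
tuples zero ℓ = [] ∷ []
tuples (suc k) ℓ = concatMap (λ m → Data.List.map (m ∷_) (tuples k ℓ)) (box ℓ)

vsum : ∀ {N k} → Vec (Vec ℕ N) k → Vec ℕ N
vsum {N} [] = replicate N 0
vsum (m ∷ ms) = m ⊕ vsum ms

-- The f-weighted vector composition number  binom k ℓ f  =
--   Σ over ordered k-tuples (m₁,…,m_k) of vectors in ℕ^N with m₁+⋯+m_k = ℓ
--   of f(m₁)⋯f(m_k).
-- Every part of such a tuple is ≤ ℓ componentwise, so it suffices to range
-- over the tuples of vectors in the box of ℓ (each tuple counted once).
binomf : ∀ {N} → (Vec ℕ N → ℕ) → ℕ → Vec ℕ N → ℕ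
binomf f k ℓ =
  sum (Data.List.map (λ ms → product (toList (Data.Vec.map f ms)))
        (filter (λ ms → vsum ms ≡? ℓ) (tuples k ℓ)))

-- Cyclic rotation of p-tuples of vectors has order p and preserves both the sum of the
-- tuple and its f-weight f(m₁)⋯f(m_p).  As p is prime, every tuple that is not constant
-- lies in a rotation orbit of exactly p tuples of equal weight, so modulo p only the
-- constant tuples (m,…,m) count.  Such a tuple sums to ℓ exactly when ℓ = p m, and then
-- contributes f(m)^p ≡ f(m) by Fermat's little theorem, which is the same orbit count
-- applied to all p-tuples over an a-element set.
module Submission where

open import Defs
open import Data.Nat using (ℕ; _≥_; _%_; NonZero)
open import Data.Nat.Primality using (Prime)
open import Data.Vec using (Vec)
open import Data.Product using (∃; _×_)
open import Relation.Binary.PropositionalEquality using (_≡_)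
open import Relation.Nullary using (¬_)

open import Data.List.Base
  using (List; []; _∷_; _++_; [_]; map; filter; applyUpTo; upTo; length; concatMap; cartesianProductWith)
open import Data.List.Properties
  using (map-applyUpTo; filter-notAll; filter-none; ++-assoc; ++-identityʳ; length-++; length-map; length-upTo)
open import Data.List.Membership.Propositional using (_∈_)
open import Data.List.Membership.Propositional.Properties
  using (∈-filter⁺; ∈-filter⁻; ∈-applyUpTo⁺; ∈-applyUpTo⁻; ∈-map⁺; ∈-map⁻; ∈-upTo⁺
        ; ∈-cartesianProductWith⁺; ∈-cartesianProductWith⁻)
open import Data.List.Membership.Propositional.Properties.WithK using (unique∧set⇒bag)
open import Data.List.Relation.Binary.BagAndSetEquality using (∼bag⇒↭)
open import Data.List.Relation.Binary.Permutation.Propositional using (_↭_; ↭-refl)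
import Data.List.Relation.Binary.Permutation.Propositional.Properties as ↭
open import Data.List.Relation.Binary.Subset.Propositional using (_⊆_)
import Data.List.Relation.Unary.All as ListAll
open import Data.List.Relation.Unary.All using ([])
open import Data.List.Relation.Unary.AllPairs using ([]; _∷_)
open import Data.List.Relation.Unary.Any using (here)
open import Data.List.Relation.Unary.Unique.Propositional using (Unique)
import Data.List.Relation.Unary.Unique.Propositional.Properties as Unique
open import Data.Nat.Base using (zero; suc; pred; _+_; _*_; _^_; _∸_; _<_; _≤_; s≤s; >-nonZero; >-nonZero⁻¹)
import Data.Nat.Properties as ℕ
open import Data.Nat.Properties
  using (+-assoc; +-comm; +-identityʳ; ≤-pred; ≤-trans; ≤-refl; ≤-<-trans; <⇒≤; m∸n≤m; m<n⇒0<n∸m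
        ; m+[n∸m]≡n; m≤n⇒m<n∨m≡n; suc-pred; *-cancelˡ-≡; m≤n*m)
open import Algebra.Properties.CommutativeSemigroup ℕ.+-commutativeSemigroup
  using () renaming (x∙yz≈y∙xz to +-left-comm)
open import Data.Nat.Coprimality using (prime⇒coprime; coprime-Bézout)
open import Data.Nat.Divisibility using (_∣_; divides; _∣0; ∣m∣n⇒∣m+n; m∣m*n)
open import Data.Nat.DivMod using ([m+kn]%n≡m%n)
open import Data.Nat.GCD using (module Bézout)
open import Data.Nat.GeneralisedArithmetic using (iterate)
open import Data.Nat.ListAction using (sum; product)
open import Data.Nat.ListAction.Properties using (sum-↭; product-↭)
open import Data.Nat.Primality using (prime⇒nonZero)
open import Data.Product.Base using (_,_; proj₁; proj₂)
open import Data.Sum.Base using (inj₁; inj₂)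
open import Data.Vec.Base as Vec using ([]; _∷_; _∷ʳ_; replicate; toList; head)
import Data.Vec.Properties as Vec
open import Data.Vec.Relation.Binary.Equality.DecPropositional ℕ._≟_ using (_≡?_)
open import Data.Vec.Relation.Binary.Pointwise.Inductive using (Pointwise; []; _∷_)
open import Data.Vec.Relation.Unary.All using ([]; _∷_) renaming (All to VecAll; head to headᴬ)
open import Function.Base using (_∘_)
open import Function.Bundles using (_⇔_; mk⇔)
open import Relation.Binary.Definitions using (DecidableEquality)
open import Relation.Binary.PropositionalEquality using (refl; sym; trans; cong; cong₂; subst; _≢_; module ≡-Reasoning)
open import Relation.Nullary.Decidable using (yes; no)
open import Relation.Unary using (Pred; Decidable)
open import Relation.Unary.Properties using (∁?)

sum-applyUpTo-const : ∀ n {g : ℕ → ℕ} {c} → (∀ i → g i ≡ c) → sum (applyUpTo g n) ≡ n * c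
sum-applyUpTo-const zero g≡c = refl
sum-applyUpTo-const (suc n) g≡c = cong₂ _+_ (g≡c 0) (sum-applyUpTo-const n (λ i → g≡c (suc i)))

module _ {a} {A : Set a} where

  sum-map-const-1 : ∀ (xs : List A) → sum (map (λ _ → 1) xs) ≡ length xs
  sum-map-const-1 [] = refl
  sum-map-const-1 (x ∷ xs) = cong suc (sum-map-const-1 xs)

  sum-map-↭ : ∀ (h : A → ℕ) {xs ys} → xs ↭ ys → sum (map h xs) ≡ sum (map h ys)
  sum-map-↭ h xs↭ys = sum-↭ (↭.map⁺ h xs↭ys)

  sum-map-filter : ∀ {p} {P : Pred A p} (P? : Decidable P) (h : A → ℕ) xs →
    sum (map h xs) ≡ sum (map h (filter P? xs)) + sum (map h (filter (∁? P?) xs))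
  sum-map-filter P? h [] = refl
  sum-map-filter P? h (x ∷ xs) with P? x
  ... | yes _ = trans (cong (h x +_) (sum-map-filter P? h xs)) (sym (+-assoc (h x) _ _))
  ... | no _ = trans (cong (h x +_) (sum-map-filter P? h xs))
                     (+-left-comm (h x) (sum (map h (filter P? xs))) (sum (map h (filter (∁? P?) xs))))

  unique∧set⇒↭ : ∀ {xs ys : List A} → Unique xs → Unique ys → (∀ {z} → z ∈ xs ⇔ z ∈ ys) → xs ↭ ys
  unique∧set⇒↭ xs! ys! xs⇔ys = ∼bag⇒↭ (unique∧set⇒bag xs! ys! xs⇔ys)

  module _ (_≟_ : DecidableEquality A) where
    open import Data.List.Membership.DecPropositional _≟_ using (_∈?_)

    filter-∈-↭ : ∀ {xs ys : List A} → Unique xs → Unique ys → ys ⊆ xs → filter (_∈? ys) xs ↭ ys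
    filter-∈-↭ {xs} {ys} xs! ys! ys⊆xs = unique∧set⇒↭ (Unique.filter⁺ (_∈? ys) xs!) ys!
      (mk⇔ (λ z∈ → proj₂ (∈-filter⁻ (_∈? ys) {xs = xs} z∈)) (λ z∈ys → ∈-filter⁺ (_∈? ys) (ys⊆xs z∈ys) z∈ys))

module _ {a} {A : Set a} (f : A → A) where

  iterate-+ : ∀ x m n → iterate f x (m + n) ≡ iterate f (iterate f x m) n
  iterate-+ x zero n = refl
  iterate-+ x (suc m) n = iterate-+ (f x) m n

  iterate-suc : ∀ x n → iterate f x (suc n) ≡ f (iterate f x n)
  iterate-suc x zero = refl
  iterate-suc x (suc n) = iterate-suc (f x) n

  iterate-periodic : ∀ {x d} → iterate f x d ≡ x → ∀ q → iterate f x (q * d) ≡ x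
  iterate-periodic e zero = refl
  iterate-periodic {x} {d} e (suc q) = trans (iterate-+ x d (q * d))
    (trans (cong (λ y → iterate f y (q * d)) e) (iterate-periodic e q))

  fixed-if-consecutive-periods : ∀ {x} m → iterate f x m ≡ x → iterate f x (suc m) ≡ x → f x ≡ x
  fixed-if-consecutive-periods {x} m x-m x-1+m = begin
    f x                  ≡⟨ cong f x-m ⟨
    f (iterate f x m)    ≡⟨ iterate-suc x m ⟨
    iterate f x (suc m)  ≡⟨ x-1+m ⟩
    x                    ∎
    where open ≡-Reasoning

  -- By Bézout, some multiple of one period is one more than a multiple of the other.
  fixed-if-coprime-periods : ∀ {x p d} → Prime p → 0 < d → d < p →
    iterate f x p ≡ x → iterate f x d ≡ x → f x ≡ x
  fixed-if-coprime-periods {x} {p} {d} p-prime 0<d d<p x-p x-d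
    with coprime-Bézout (prime⇒coprime p-prime {{>-nonZero 0<d}} d<p)
  ... | Bézout.+- i j 1+jd≡ip = fixed-if-consecutive-periods (j * d) (iterate-periodic x-d j)
                                  (subst (λ n → iterate f x n ≡ x) (sym 1+jd≡ip) (iterate-periodic x-p i))
  ... | Bézout.-+ i j 1+ip≡jd = fixed-if-consecutive-periods (i * p) (iterate-periodic x-p i)
                                  (subst (λ n → iterate f x n ≡ x) (sym 1+ip≡jd) (iterate-periodic x-d j))

module Necklace {a} {A : Set a} (_≟_ : DecidableEquality A) (σ : A → A)
                {p} (p-prime : Prime p) (σ-period : ∀ x → iterate σ x p ≡ x) where

  open import Data.List.Membership.DecPropositional _≟_ using (_∈?_; _∉?_)

  Fixed : Pred A a
  Fixed x = σ x ≡ x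

  fixed? : Decidable Fixed
  fixed? x = σ x ≟ x

  Closed : List A → Set a
  Closed xs = ∀ {x} → x ∈ xs → σ x ∈ xs

  iterate-σ-pred : ∀ x → iterate σ (σ x) (pred p) ≡ x
  iterate-σ-pred x = trans (cong (iterate σ x) (suc-pred p {{prime⇒nonZero p-prime}})) (σ-period x)

  σ-injective : ∀ {x y} → σ x ≡ σ y → x ≡ y
  σ-injective {x} {y} σx≡σy = trans (sym (iterate-σ-pred x))
    (trans (cong (λ z → iterate σ z (pred p)) σx≡σy) (iterate-σ-pred y))

  fixed-iterate⁻ : ∀ x i → Fixed (iterate σ x i) → Fixed x
  fixed-iterate⁻ x zero fixed = fixed
  fixed-iterate⁻ x (suc i) fixed = σ-injective (fixed-iterate⁻ (σ x) i fixed)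

  iterate-∈ : ∀ {xs} → Closed xs → ∀ {x} n → x ∈ xs → iterate σ x n ∈ xs
  iterate-∈ closed zero x∈ = x∈
  iterate-∈ closed (suc n) x∈ = iterate-∈ closed n (closed x∈)

  ∈-σ⁻ : ∀ {xs} → Closed xs → ∀ {x} → σ x ∈ xs → x ∈ xs
  ∈-σ⁻ closed {x} σx∈ = subst (_∈ _) (iterate-σ-pred x) (iterate-∈ closed (pred p) σx∈)

  filter-closed : ∀ {ℓ} {P : Pred A ℓ} (P? : Decidable P) → (∀ {x} → P x → P (σ x)) →
                  ∀ {xs} → Closed xs → Closed (filter P? xs)
  filter-closed P? σ-pres {xs} closed x∈ with ∈-filter⁻ P? {xs = xs} x∈
  ... | x∈xs , Px = ∈-filter⁺ P? (closed x∈xs) (σ-pres Px)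

  orbit : A → List A
  orbit x = applyUpTo (iterate σ x) p

  x∈orbit : ∀ x → x ∈ orbit x
  x∈orbit x = ∈-applyUpTo⁺ (iterate σ x) (>-nonZero⁻¹ p {{prime⇒nonZero p-prime}})

  orbit-closed : ∀ x → Closed (orbit x)
  orbit-closed x z∈ with ∈-applyUpTo⁻ (iterate σ x) z∈
  ... | i , i<p , refl with m≤n⇒m<n∨m≡n i<p
  ... | inj₁ 1+i<p = subst (_∈ orbit x) (iterate-suc σ x i) (∈-applyUpTo⁺ (iterate σ x) 1+i<p)
  ... | inj₂ refl = subst (_∈ orbit x) (trans (sym (σ-period x)) (iterate-suc σ x i)) (x∈orbit x)

  orbit-⊆ : ∀ {xs} → Closed xs → ∀ {x} → x ∈ xs → orbit x ⊆ xs
  orbit-⊆ closed x∈ z∈ with ∈-applyUpTo⁻ (iterate σ _) z∈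
  ... | i , _ , refl = iterate-∈ closed i x∈

  orbit-unique : ∀ {x} → ¬ Fixed x → Unique (orbit x)
  orbit-unique {x} unfixed = Unique.applyUpTo⁺₁ (iterate σ x) p distinct
    where
    distinct : ∀ {i j} → i < j → j < p → iterate σ x i ≢ iterate σ x j
    distinct {i} {j} i<j j<p xᵢ≡xⱼ = unfixed (fixed-iterate⁻ x i (fixed-if-coprime-periods σ p-prime
      (m<n⇒0<n∸m i<j) (≤-<-trans (m∸n≤m j i) j<p) (σ-period (iterate σ x i)) returns))
      where
      open ≡-Reasoning
      returns : iterate σ (iterate σ x i) (j ∸ i) ≡ iterate σ x i
      returns = begin
        iterate σ (iterate σ x i) (j ∸ i)  ≡⟨ iterate-+ σ x i (j ∸ i) ⟨
        iterate σ x (i + (j ∸ i))          ≡⟨ cong (iterate σ x) (m+[n∸m]≡n (<⇒≤ i<j)) ⟩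
        iterate σ x j                      ≡⟨ xᵢ≡xⱼ ⟨
        iterate σ x i                      ∎

  module _ (h : A → ℕ) (h-invariant : ∀ x → h (σ x) ≡ h x) where

    h-iterate : ∀ x n → h (iterate σ x n) ≡ h x
    h-iterate x zero = refl
    h-iterate x (suc n) = trans (h-iterate (σ x) n) (h-invariant x)

    sum-orbit : ∀ x → sum (map h (orbit x)) ≡ p * h x
    sum-orbit x = trans (cong sum (map-applyUpTo (iterate σ x) h p)) (sum-applyUpTo-const p (h-iterate x))

    -- Split off the orbit of the head: p distinct points of equal weight.  What remains
    -- is again closed, since σ z ∈ orbit x forces z ∈ orbit x.
    p∣sum-of-fixed-point-free : ∀ n xs → length xs ≤ n → Unique xs → Closed xs →
                                (∀ {x} → x ∈ xs → ¬ Fixed x) → p ∣ sum (map h xs)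
    p∣sum-of-fixed-point-free n [] _ _ _ _ = p ∣0
    p∣sum-of-fixed-point-free (suc n) xs@(x ∷ _) |xs|≤1+n xs! closed free =
      subst (p ∣_) (sym (sum-map-filter (_∈? orbit x) h xs)) (∣m∣n⇒∣m+n p∣orbit-sum p∣rest-sum)
      where
      rest = filter (_∉? orbit x) xs
      p∣orbit-sum : p ∣ sum (map h (filter (_∈? orbit x) xs))
      p∣orbit-sum = subst (p ∣_)
        (sym (trans (sum-map-↭ h (filter-∈-↭ _≟_ xs! (orbit-unique (free (here refl))) (orbit-⊆ closed (here refl))))
                    (sum-orbit x)))
        (m∣m*n (h x))
      |rest|<|xs| : length rest < length xs
      |rest|<|xs| = filter-notAll (_∉? orbit x) xs (here (λ x∉ → x∉ (x∈orbit x)))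
      p∣rest-sum : p ∣ sum (map h rest)
      p∣rest-sum = p∣sum-of-fixed-point-free n rest (≤-pred (≤-trans |rest|<|xs| |xs|≤1+n))
        (Unique.filter⁺ (_∉? orbit x) xs!)
        (filter-closed (_∉? orbit x) (λ x∉ σx∈ → x∉ (∈-σ⁻ (orbit-closed x) σx∈)) closed)
        (λ z∈ → free (proj₁ (∈-filter⁻ (_∉? orbit x) {xs = xs} z∈)))

    sum≡sum-fixed-mod-p : .{{_ : NonZero p}} → ∀ xs → Unique xs → Closed xs →
                          sum (map h xs) % p ≡ sum (map h (filter fixed? xs)) % p
    sum≡sum-fixed-mod-p xs xs! closed with p∣sum-of-fixed-point-free _ (filter (∁? fixed?) xs) ≤-refl
      (Unique.filter⁺ (∁? fixed?) xs!)
      (filter-closed (∁? fixed?) (λ unfixed fixed → unfixed (σ-injective fixed)) closed)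
      (λ z∈ → proj₂ (∈-filter⁻ (∁? fixed?) {xs = xs} z∈))
    ... | divides q eq = begin
      sum (map h xs) % p                                     ≡⟨ cong (_% p) (sum-map-filter fixed? h xs) ⟩
      (fixedSum + sum (map h (filter (∁? fixed?) xs))) % p  ≡⟨ cong (λ s → (fixedSum + s) % p) eq ⟩
      (fixedSum + q * p) % p                                 ≡⟨ [m+kn]%n≡m%n fixedSum q p ⟩
      fixedSum % p                                           ∎
      where
      open ≡-Reasoning
      fixedSum = sum (map h (filter fixed? xs))

module _ {a} {A : Set a} where

  vectors : ∀ k → List A → List (Vec A k)
  vectors zero B = [ [] ]
  vectors (suc k) B = cartesianProductWith _∷_ B (vectors k B)

  ∈-vectors⁺ : ∀ {k B} {t : Vec A k} → VecAll (_∈ B) t → t ∈ vectors k B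
  ∈-vectors⁺ [] = here refl
  ∈-vectors⁺ (b∈ ∷ t∈) = ∈-cartesianProductWith⁺ _∷_ b∈ (∈-vectors⁺ t∈)

  ∈-vectors⁻ : ∀ {k} B {t : Vec A k} → t ∈ vectors k B → VecAll (_∈ B) t
  ∈-vectors⁻ {zero} B {[]} _ = []
  ∈-vectors⁻ {suc k} B t∈ with ∈-cartesianProductWith⁻ _∷_ B (vectors k B) t∈
  ... | _ , _ , b∈ , u∈ , refl = b∈ ∷ ∈-vectors⁻ B u∈

  vectors-unique : ∀ k {B} → Unique B → Unique (vectors k B)
  vectors-unique zero B! = [] ∷ []
  vectors-unique (suc k) B! = Unique.cartesianProductWith⁺ _∷_ Vec.∷-injective B! (vectors-unique k B!)

  length-vectors : ∀ k B → length (vectors k B) ≡ length B ^ k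
  length-vectors zero B = refl
  length-vectors (suc k) B =
    trans (length-cartesianProductWith B (vectors k B)) (cong (length B *_) (length-vectors k B))
    where
    length-cartesianProductWith : ∀ {n} (xs : List A) (ys : List (Vec A n)) →
      length (cartesianProductWith _∷_ xs ys) ≡ length xs * length ys
    length-cartesianProductWith [] ys = refl
    length-cartesianProductWith (x ∷ xs) ys = trans (length-++ (map (x ∷_) ys))
      (cong₂ _+_ (length-map (x ∷_) ys) (length-cartesianProductWith xs ys))

  rotate : ∀ {n} → Vec A n → Vec A n
  rotate [] = []
  rotate (x ∷ xs) = xs ∷ʳ x

  toList-rotate-↭ : ∀ {n} (t : Vec A n) → toList (rotate t) ↭ toList t
  toList-rotate-↭ [] = ↭-refl
  toList-rotate-↭ (x ∷ xs) = subst (_↭ x ∷ toList xs) (sym (Vec.toList-∷ʳ x xs)) (↭.++-comm (toList xs) [ x ])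

  -- The period is computed on lists, where a tuple splits as xs ++ ys without index arithmetic.
  private
    rotateList : List A → List A
    rotateList [] = []
    rotateList (x ∷ xs) = xs ++ [ x ]

    iterate-rotateList-++ : ∀ xs ys → iterate rotateList (xs ++ ys) (length xs) ≡ ys ++ xs
    iterate-rotateList-++ [] ys = sym (++-identityʳ ys)
    iterate-rotateList-++ (x ∷ xs) ys = begin
      iterate rotateList ((xs ++ ys) ++ [ x ]) (length xs)
        ≡⟨ cong (λ zs → iterate rotateList zs (length xs)) (++-assoc xs ys [ x ]) ⟩
      iterate rotateList (xs ++ ys ++ [ x ]) (length xs)
        ≡⟨ iterate-rotateList-++ xs (ys ++ [ x ]) ⟩
      (ys ++ [ x ]) ++ xs
        ≡⟨ ++-assoc ys [ x ] xs ⟩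
      ys ++ x ∷ xs
        ∎
      where open ≡-Reasoning

    toList-iterate-rotate : ∀ {n} (t : Vec A n) i → toList (iterate rotate t i) ≡ iterate rotateList (toList t) i
    toList-iterate-rotate t zero = refl
    toList-iterate-rotate [] (suc i) = toList-iterate-rotate [] i
    toList-iterate-rotate (x ∷ xs) (suc i) = trans (toList-iterate-rotate (xs ∷ʳ x) i)
      (cong (λ zs → iterate rotateList zs i) (Vec.toList-∷ʳ x xs))

  rotate-period : ∀ {n} (t : Vec A n) → iterate rotate t n ≡ t
  rotate-period {n} t = trans (sym (Vec.cast-is-id refl _)) (Vec.toList-injective refl (iterate rotate t n) t (begin
    toList (iterate rotate t n)                              ≡⟨ toList-iterate-rotate t n ⟩
    iterate rotateList (toList t) n                          ≡⟨ cong (iterate rotateList (toList t)) (Vec.length-toList t) ⟨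
    iterate rotateList (toList t) (length (toList t))        ≡⟨ cong (λ zs → iterate rotateList zs (length (toList t)))
                                                                     (++-identityʳ (toList t)) ⟨
    iterate rotateList (toList t ++ []) (length (toList t))  ≡⟨ iterate-rotateList-++ (toList t) [] ⟩
    toList t                                                 ∎))
    where open ≡-Reasoning

  All-rotate⁺ : ∀ {ℓ} {P : Pred A ℓ} {n} {t : Vec A n} → VecAll P t → VecAll P (rotate t)
  All-rotate⁺ [] = []
  All-rotate⁺ {P = P} (px ∷ pxs) = ∷ʳ⁺ pxs
    where
    ∷ʳ⁺ : ∀ {n} {xs : Vec A n} → VecAll P xs → VecAll P (xs ∷ʳ _)
    ∷ʳ⁺ [] = px ∷ []
    ∷ʳ⁺ (py ∷ pys) = py ∷ ∷ʳ⁺ pys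

  All-replicate⁺ : ∀ {ℓ} {P : Pred A ℓ} n {x} → P x → VecAll P (replicate n x)
  All-replicate⁺ zero px = []
  All-replicate⁺ (suc n) px = px ∷ All-replicate⁺ n px

  rotate-∈-vectors : ∀ {k B} {t : Vec A k} → t ∈ vectors k B → rotate t ∈ vectors k B
  rotate-∈-vectors {B = B} t∈ = ∈-vectors⁺ (All-rotate⁺ (∈-vectors⁻ B t∈))

  rotate-replicate : ∀ n x → rotate (replicate n x) ≡ replicate n x
  rotate-replicate zero x = refl
  rotate-replicate (suc n) x = ∷ʳ-replicate n
    where
    ∷ʳ-replicate : ∀ n → replicate n x ∷ʳ x ≡ x ∷ replicate n x
    ∷ʳ-replicate zero = refl
    ∷ʳ-replicate (suc n) = cong (x ∷_) (∷ʳ-replicate n)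

  rotate-fixed⇒replicate : ∀ {n} (t : Vec A (suc n)) → rotate t ≡ t → t ≡ replicate (suc n) (head t)
  rotate-fixed⇒replicate (x ∷ xs) fixed = cong (x ∷_) (∷ʳ-fixed xs fixed)
    where
    ∷ʳ-fixed : ∀ {n} (xs : Vec A n) {x} → xs ∷ʳ x ≡ x ∷ xs → xs ≡ replicate n x
    ∷ʳ-fixed [] _ = refl
    ∷ʳ-fixed (y ∷ ys) eq with Vec.∷-injective eq
    ... | refl , eq′ = cong (y ∷_) (∷ʳ-fixed ys eq′)

  module _ (_≟_ : DecidableEquality A) where
    private
      _≟ᵥ_ : ∀ {n} → DecidableEquality (Vec A n)
      _≟ᵥ_ = Vec.≡-dec _≟_

    filter-rotate-fixed-vectors : ∀ n .{{_ : NonZero n}} {B} → Unique B →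
      filter (λ t → rotate t ≟ᵥ t) (vectors n B) ↭ map (replicate n) B
    filter-rotate-fixed-vectors (suc n) {B} B! = unique∧set⇒↭
      (Unique.filter⁺ (λ t → rotate t ≟ᵥ t) (vectors-unique (suc n) B!))
      (Unique.map⁺ Vec.∷-injectiveˡ B!)
      (mk⇔ constant constant⁻¹)
      where
      constant : ∀ {t} → t ∈ filter (λ t → rotate t ≟ᵥ t) (vectors (suc n) B) → t ∈ map (replicate (suc n)) B
      constant {t@(_ ∷ _)} t∈ with ∈-filter⁻ (λ t → rotate t ≟ᵥ t) {xs = vectors (suc n) B} t∈
      ... | t∈V , fixed = subst (_∈ map (replicate (suc n)) B) (sym (rotate-fixed⇒replicate t fixed))
                            (∈-map⁺ (replicate (suc n)) (headᴬ (∈-vectors⁻ B t∈V)))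
      constant⁻¹ : ∀ {t} → t ∈ map (replicate (suc n)) B → t ∈ filter (λ t → rotate t ≟ᵥ t) (vectors (suc n) B)
      constant⁻¹ t∈ with ∈-map⁻ (replicate (suc n)) t∈
      ... | x , x∈ , refl = ∈-filter⁺ (λ t → rotate t ≟ᵥ t) (∈-vectors⁺ (All-replicate⁺ (suc n) x∈))
                              (rotate-replicate (suc n) x)

fermat : ∀ {p} .{{_ : NonZero p}} → Prime p → ∀ a → a ^ p % p ≡ a % p
fermat {p} p-prime a = begin
  a ^ p % p                                           ≡⟨ cong (λ n → n ^ p % p) (length-upTo a) ⟨
  length (upTo a) ^ p % p                             ≡⟨ cong (_% p) (trans (sum-map-const-1 V) (length-vectors p (upTo a))) ⟨
  sum (map one V) % p                                 ≡⟨ Necklace.sum≡sum-fixed-mod-p (Vec.≡-dec ℕ._≟_) rotate p-prime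
                                                           rotate-period one (λ _ → refl) V
                                                           (vectors-unique p (Unique.upTo⁺ a)) rotate-∈-vectors ⟩
  sum (map one (filter (λ t → rotate t ≟ᵥ t) V)) % p  ≡⟨ cong (_% p) (sum-map-↭ one
                                                           (filter-rotate-fixed-vectors ℕ._≟_ p (Unique.upTo⁺ a))) ⟩
  sum (map one (map (replicate p) (upTo a))) % p      ≡⟨ cong (_% p) (sum-map-const-1 (map (replicate p) (upTo a))) ⟩
  length (map (replicate p) (upTo a)) % p             ≡⟨ cong (_% p) (trans (length-map (replicate p) (upTo a)) (length-upTo a)) ⟩
  a % p                                               ∎
  where
  open ≡-Reasoning
  _≟ᵥ_ = Vec.≡-dec {n = p} ℕ._≟_
  V = vectors p (upTo a)
  one : Vec ℕ p → ℕ
  one _ = 1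

concatMap-map≡cartesianProductWith : ∀ {a b c} {A : Set a} {B : Set b} {C : Set c} (f : A → B → C) xs ys →
  concatMap (λ x → map (f x) ys) xs ≡ cartesianProductWith f xs ys
concatMap-map≡cartesianProductWith f [] ys = refl
concatMap-map≡cartesianProductWith f (x ∷ xs) ys = cong (map (f x) ys ++_) (concatMap-map≡cartesianProductWith f xs ys)

box-unique : ∀ {N} (ℓ : Vec ℕ N) → Unique (box ℓ)
box-unique [] = [] ∷ []
box-unique (l ∷ ℓ) = subst Unique (sym (concatMap-map≡cartesianProductWith _∷_ (upTo (suc l)) (box ℓ)))
  (Unique.cartesianProductWith⁺ _∷_ Vec.∷-injective (Unique.upTo⁺ (suc l)) (box-unique ℓ))

∈-box⁺ : ∀ {N} {m ℓ : Vec ℕ N} → Pointwise _≤_ m ℓ → m ∈ box ℓ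
∈-box⁺ [] = here refl
∈-box⁺ {m = x ∷ m} {l ∷ ℓ} (x≤l ∷ m≤ℓ) = subst (x ∷ m ∈_) (sym (concatMap-map≡cartesianProductWith _∷_ (upTo (suc l)) (box ℓ)))
  (∈-cartesianProductWith⁺ _∷_ (∈-upTo⁺ (s≤s x≤l)) (∈-box⁺ m≤ℓ))

tuples≡vectors : ∀ {N} k (ℓ : Vec ℕ N) → tuples k ℓ ≡ vectors k (box ℓ)
tuples≡vectors zero ℓ = refl
tuples≡vectors (suc k) ℓ = trans (concatMap-map≡cartesianProductWith _∷_ (box ℓ) (tuples k ℓ))
  (cong (cartesianProductWith _∷_ (box ℓ)) (tuples≡vectors k ℓ))

⊕-left-comm : ∀ {N} (x y z : Vec ℕ N) → x ⊕ (y ⊕ z) ≡ y ⊕ (x ⊕ z)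
⊕-left-comm x y z = begin
  x ⊕ (y ⊕ z)  ≡⟨ Vec.zipWith-assoc +-assoc x y z ⟨
  (x ⊕ y) ⊕ z  ≡⟨ cong (_⊕ z) (Vec.zipWith-comm +-comm x y) ⟩
  (y ⊕ x) ⊕ z  ≡⟨ Vec.zipWith-assoc +-assoc y x z ⟩
  y ⊕ (x ⊕ z)  ∎
  where open ≡-Reasoning

vsum-rotate : ∀ {N k} (t : Vec (Vec ℕ N) k) → vsum (rotate t) ≡ vsum t
vsum-rotate [] = refl
vsum-rotate {N} (x ∷ xs) = vsum-∷ʳ xs
  where
  vsum-∷ʳ : ∀ {k} (xs : Vec (Vec ℕ N) k) → vsum (xs ∷ʳ x) ≡ x ⊕ vsum xs
  vsum-∷ʳ [] = refl
  vsum-∷ʳ (y ∷ xs) = trans (cong (y ⊕_) (vsum-∷ʳ xs)) (⊕-left-comm y x (vsum xs))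

·-suc : ∀ {N} n (x : Vec ℕ N) → x ⊕ (n · x) ≡ suc n · x
·-suc n [] = refl
·-suc n (xᵢ ∷ x) = cong (xᵢ + n * xᵢ ∷_) (·-suc n x)

vsum-replicate : ∀ {N} n (x : Vec ℕ N) → vsum (replicate n x) ≡ n · x
vsum-replicate zero x = sym (Vec.map-const x 0)
vsum-replicate (suc n) x = trans (cong (x ⊕_) (vsum-replicate n x)) (·-suc n x)

·-injective : ∀ {N} p .{{_ : NonZero p}} {x y : Vec ℕ N} → p · x ≡ p · y → x ≡ y
·-injective p {[]} {[]} _ = refl
·-injective p {_ ∷ _} {_ ∷ _} eq =
  cong₂ _∷_ (*-cancelˡ-≡ _ _ p (Vec.∷-injectiveˡ eq)) (·-injective p (Vec.∷-injectiveʳ eq))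

≤-· : ∀ {N} p .{{_ : NonZero p}} (x : Vec ℕ N) → Pointwise _≤_ x (p · x)
≤-· p [] = []
≤-· p (xᵢ ∷ x) = m≤n*m xᵢ p ∷ ≤-· p x

module _ {N} (f : Vec ℕ N → ℕ) where

  weight : ∀ {k} → Vec (Vec ℕ N) k → ℕ
  weight t = product (toList (Vec.map f t))

  weight-rotate : ∀ {k} (t : Vec (Vec ℕ N) k) → weight (rotate t) ≡ weight t
  weight-rotate [] = refl
  weight-rotate (x ∷ xs) = trans (cong (product ∘ toList) (Vec.map-∷ʳ f x xs))
    (product-↭ (toList-rotate-↭ (Vec.map f (x ∷ xs))))

  weight-replicate : ∀ n x → weight (replicate n x) ≡ f x ^ n
  weight-replicate zero x = refl
  weight-replicate (suc n) x = cong (f x *_) (weight-replicate n x)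

module Compositions {N} (f : Vec ℕ N → ℕ) {k} (p-prime : Prime (suc k)) (ℓ : Vec ℕ N) where

  p : ℕ
  p = suc k

  open Necklace (Vec.≡-dec (_≡?_ {N})) rotate p-prime (rotate-period {n = p}) public

  compositions : List (Vec (Vec ℕ N) p)
  compositions = filter (λ t → vsum t ≡? ℓ) (vectors p (box ℓ))

  binomf≡fixed-compositions-mod-p : binomf f p ℓ % p ≡ sum (map (weight f) (filter fixed? compositions)) % p
  binomf≡fixed-compositions-mod-p = begin
    binomf f p ℓ % p
      ≡⟨ cong (λ ts → sum (map (weight f) (filter (λ t → vsum t ≡? ℓ) ts)) % p) (tuples≡vectors p ℓ) ⟩
    sum (map (weight f) compositions) % p
      ≡⟨ sum≡sum-fixed-mod-p (weight f) (weight-rotate f) compositions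
           (Unique.filter⁺ (λ t → vsum t ≡? ℓ) (vectors-unique p (box-unique ℓ)))
           (filter-closed (λ t → vsum t ≡? ℓ) (λ {t} sums-to-ℓ → trans (vsum-rotate t) sums-to-ℓ)
              (rotate-∈-vectors {B = box ℓ})) ⟩
    sum (map (weight f) (filter fixed? compositions)) % p
      ∎
    where open ≡-Reasoning

  fixed-composition-constant : ∀ {t : Vec (Vec ℕ N) p} → t ∈ filter fixed? compositions →
                               t ≡ replicate p (head t) × ℓ ≡ p · head t
  fixed-composition-constant {t@(_ ∷ _)} t∈ with ∈-filter⁻ fixed? {xs = compositions} t∈
  ... | t∈compositions , fixed with ∈-filter⁻ (λ t → vsum t ≡? ℓ) {xs = vectors p (box ℓ)} t∈compositions
  ... | _ , sums-to-ℓ = t-constant , trans (sym sums-to-ℓ) (trans (cong vsum t-constant) (vsum-replicate p (head t)))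
    where
    t-constant = rotate-fixed⇒replicate t fixed

  fixed-compositions-↭ : ∀ {m} → ℓ ≡ p · m → filter fixed? compositions ↭ [ replicate p m ]
  fixed-compositions-↭ {m} ℓ≡pm = unique∧set⇒↭
    (Unique.filter⁺ fixed? (Unique.filter⁺ (λ t → vsum t ≡? ℓ) (vectors-unique p (box-unique ℓ))))
    ([] ∷ [])
    (mk⇔ (λ t∈ → here (is-replicate-m t∈)) λ { (here refl) → replicate-m∈ })
    where
    is-replicate-m : ∀ {t} → t ∈ filter fixed? compositions → t ≡ replicate p m
    is-replicate-m t∈ with fixed-composition-constant t∈
    ... | t-constant , ℓ≡p·head = trans t-constant (cong (replicate p) (·-injective p (trans (sym ℓ≡p·head) ℓ≡pm)))
    replicate-m∈ : replicate p m ∈ filter fixed? compositions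
    replicate-m∈ = ∈-filter⁺ fixed?
      (∈-filter⁺ (λ t → vsum t ≡? ℓ)
        (∈-vectors⁺ (All-replicate⁺ p (subst (λ ℓ → m ∈ box ℓ) (sym ℓ≡pm) (∈-box⁺ (≤-· p m)))))
        (trans (vsum-replicate p m) (sym ℓ≡pm)))
      (rotate-replicate p m)

  fixed-compositions-none : ¬ (∃ λ m → ℓ ≡ p · m) → filter fixed? compositions ≡ []
  fixed-compositions-none ∄m = filter-none fixed? (ListAll.tabulate {xs = compositions} λ t∈ fixed →
    ∄m (_ , proj₂ (fixed-composition-constant (∈-filter⁺ fixed? t∈ fixed))))

theorem6 : (N : ℕ) → N ≥ 1 → (f : Vec ℕ N → ℕ) → (p : ℕ) → .{{_ : NonZero p}} → Prime p → (ℓ : Vec ℕ N) → ((m : Vec ℕ N) → ℓ ≡ p · m → binomf f p ℓ % p ≡ f m % p) × (¬ (∃ λ m → ℓ ≡ p · m) → binomf f p ℓ % p ≡ 0)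
theorem6 N _ f (suc k) p-prime ℓ = multiple-case , non-multiple-case
  where
  open Compositions f p-prime ℓ
  multiple-case : ∀ m → ℓ ≡ p · m → binomf f p ℓ % p ≡ f m % p
  multiple-case m ℓ≡pm = begin
    binomf f p ℓ % p                                       ≡⟨ binomf≡fixed-compositions-mod-p ⟩
    sum (map (weight f) (filter fixed? compositions)) % p  ≡⟨ cong (_% p) (sum-map-↭ (weight f) (fixed-compositions-↭ ℓ≡pm)) ⟩
    (weight f (replicate p m) + 0) % p                     ≡⟨ cong (_% p) (trans (+-identityʳ _) (weight-replicate f p m)) ⟩
    f m ^ p % p                                            ≡⟨ fermat p-prime (f m) ⟩
    f m % p                                                ∎
    where open ≡-Reasoning
  non-multiple-case : ¬ (∃ λ m → ℓ ≡ p · m) → binomf f p ℓ % p ≡ 0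
  non-multiple-case ∄m = trans binomf≡fixed-compositions-mod-p
    (cong (λ ts → sum (map (weight f) ts) % p) (fixed-compositions-none ∄m))
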